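{- Let $n\ge 0$, let $M,N\in\mathcal{M}(n)$ be two (not necessarily distinct) matchings, let $s,t\in\{cr,ne\}$ and $u,v\in\{cn,nc\}$ (allowing $s=t$ and $u=v$). 1. If $s(\mathcal{T}(M,l))=t(\mathcal{T}(N,l))$ for $l=0,1$, then $s(\mathcal{T}(M,l))=t(\mathcal{T}(N,l))$ for all $l\ge 0$. 2. If $u(\mathcal{T}(M,l))=v(\mathcal{T}(N,l))$ for $l=0,1$, then $u(\mathcal{T}(M,l))=v(\mathcal{T}(N,l))$ for all $l\ge 0$. Here all equalities are equalities of multisets.
   Context: A matching on $[2n]=\{1,\dots,2n\}$ is a partition of $[2n]$ into $n$ two-element blocks (edges); $\mathcal{M}(n)$ is the set of matchings on $[2n]$, with $\mathcal{M}(0)=\{\emptyset\}$. Two distinct edges $A,B$ cross if $\min A<\min B<\max A<\max B$ or vice versa; they are nested if $\min A<\min B<\max B<\max A$ or vice versa. $cr(M)$ and $ne(M)$ are the numbers of crossing pairs and of nested pairs of edges in $M$; $cn(M)=(cr(M),ne(M))\in\mathbb{N}_0^2$ and $nc(M)=(ne(M),cr(M))$. For $M\in\mathcal{M}(n)$, a child of $M$ is any matching in $\mathcal{M}(n+1)$ obtained by choosing $x\in\{2,\dots,2n+2\}$, relabeling the vertices of $M$ order-preservingly by $\{2,\dots,2n+2\}\setminus\{x\}$, and adding the edge $\{1,x\}$. $\mathcal{T}(M,0)=\{M\}$ and $\mathcal{T}(M,l+1)$ is the set of all children of members of $\mathcal{T}(M,l)$ (equivalently, the matchings in $\mathcal{M}(n+l)$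 whose last $n$ edges, edges ordered by their smaller elements, form a matching order-isomorphic to $M$). For a statistic $f$ and a set $Z$ of matchings, $f(Z)$ is the multiset of values $f(z)$, $z\in Z$, with multiplicities. -}

module Defs where

open import Data.Nat using (ℕ; zero; suc; _+_; _*_; _<ᵇ_)
open import Data.Bool using (Bool; true; false; if_then_else_; _∧_; _∨_)
open import Data.Product using (_×_; _,_; proj₁; proj₂)
open import Data.List using (List; []; _∷_; map; length; upTo; concatMap; _++_)
open import Data.Nat.ListAction using (sum)
open import Data.List.Relation.Unary.All using (All)
open import Data.List.Relation.Binary.Permutation.Propositional using (_↭_)
open import Relation.Binary.PropositionalEquality using (_≡_)
open import Data.Nat using (_<_)

-- An edge {a,b} is stored as the ordered pair (a , b) with a < b.
Edge : Set
Edge = ℕ × ℕ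

Matching : Set
Matching = List Edge

endpoints : Matching → List ℕ
endpoints = concatMap (λ e → proj₁ e ∷ proj₂ e ∷ [])

oneTo : ℕ → List ℕ
oneTo k = map suc (upTo k)

record IsMatching (n : ℕ) (M : Matching) : Set where
  field
    size    : length M ≡ n
    ordered : All (λ e → proj₁ e < proj₂ e) M
    covers  : endpoints M ↭ oneTo (2 * n)

pairs : {A : Set} → List A → List (A × A)
pairs []       = []
pairs (x ∷ xs) = map (λ y → x , y) xs ++ pairs xs

crossesᵇ : Edge → Edge → Bool
crossesᵇ (a , b) (c , d) =
  ((a <ᵇ c) ∧ (c <ᵇ b) ∧ (b <ᵇ d)) ∨ ((c <ᵇ a) ∧ (a <ᵇ d) ∧ (d <ᵇ b))

nestedᵇ : Edge → Edge → Bool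
nestedᵇ (a , b) (c , d) =
  ((a <ᵇ c) ∧ (c <ᵇ d) ∧ (d <ᵇ b)) ∨ ((c <ᵇ a) ∧ (a <ᵇ b) ∧ (b <ᵇ d))

countPairs : (Edge → Edge → Bool) → Matching → ℕ
countPairs P M = sum (map (λ p → if P (proj₁ p) (proj₂ p) then 1 else 0) (pairs M))

cr : Matching → ℕ
cr = countPairs crossesᵇ

ne : Matching → ℕ
ne = countPairs nestedᵇ

cn : Matching → ℕ × ℕ
cn M = cr M , ne M

nc : Matching → ℕ × ℕ
nc M = ne M , cr M

data Stat : Set where
  CR NE : Stat

stat : Stat → Matching → ℕ
stat CR = cr
stat NE = ne

data PairStat : Set where
  CN NC : PairStat

pairStat : PairStat → Matching → ℕ × ℕ
pairStat CN = cn
pairStat NC = nc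

-- relabel a vertex v of [2n] order-preservingly onto {2..2n+2} \ {x}
shift : ℕ → ℕ → ℕ
shift x v = if suc v <ᵇ x then suc v else suc (suc v)

child : Matching → ℕ → Matching
child M x = (1 , x) ∷ map (λ e → shift x (proj₁ e) , shift x (proj₂ e)) M

children : Matching → List Matching
children M = map (λ i → child M (2 + i)) (upTo (suc (2 * length M)))

-- 𝓣(M,l) as a list (its entries are pairwise distinct, so it represents the set)
T : Matching → ℕ → List Matching
T M zero    = M ∷ []
T M (suc l) = concatMap children (T M l)

-- Closing the new edge {1, k + 2} of a child at gap k adds to (cr, ne) the numbers of
-- edges of M spanning gap k and lying left of gap k. The list w₀ … w₂ₙ of these pairs over all
-- gaps is the profile of M, and the profile of that child is
-- (0,0), (1,0) + w₀, …, (1,0) + w_k, (0,1) + w_k, …, (0,1) + w₂ₙ. Hence the multiset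
-- cn(𝒯(M,l)) is cn(M) translated by a multiset computed from the profile alone.
-- Expanding that multiset as Σ_r h_r(profile) ⊛ C_{l,r}, with h_r the complete homogeneous
-- symmetric polynomials read additively and C independent of M, shows that it depends only
-- on the profile as a multiset and is symmetric in (1,0) and (0,1). For a statistic
-- linear in (cr, ne), level 0 yields its value at M and level 1 the image of the profile,
-- and these two determine every level.

module Submission where

open import Defs

open import Algebra.Bundles using (Monoid)
open import Algebra.Core using (Op₂)
open import Algebra.Structures using (IsCommutativeMonoid)
open import Algebra.Structures.Biased using (isCommutativeMonoidˡ)
import Algebra.Properties.Monoid.Mult as MonoidMultiplication
open import Data.Nat using (ℕ; zero; suc; _+_; _*_; _∸_; _≤_; _<_; z≤n; s≤s; z<s; s<s; _<ᵇ_)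
import Data.Nat.Properties as ℕ
open import Data.Bool using (Bool; true; false; if_then_else_; _∧_)
open import Data.Bool.Properties using (∨-identityʳ)
open import Data.Product using (_×_; _,_; proj₁; proj₂; swap)
open import Data.Sum using (_⊎_; inj₁; inj₂)
open import Data.List using (List; []; _∷_; [_]; _++_; map; concat; concatMap; cartesianProductWith; applyUpTo; upTo; length)
open import Data.List.Properties
  using (map-++; map-∘; map-cong; map-id; ++-assoc; ++-identityʳ; concatMap-map; map-concatMap; concatMap-cong;
         cartesianProductWith-zeroʳ; cartesianProductWith-distribʳ-++; map-applyUpTo; map-cong-local; length-map;
         concatMap-++; concatMap-pure; map-upTo; ∷-injectiveˡ)
open import Data.Nat.ListAction using (sum)
open import Data.Nat.ListAction.Properties using (sum-++)
open import Data.List.Relation.Unary.All as All using (All; []; _∷_)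
open import Data.List.Relation.Unary.All.Properties using () renaming (map⁺ to map⁺ₐ)
open import Data.List.Relation.Binary.Permutation.Propositional as Perm
  using (_↭_; ↭-refl; ↭-sym; ↭-trans; ↭-reflexive; module PermutationReasoning)
open import Data.List.Relation.Binary.Permutation.Propositional.Properties
  using (++⁺ˡ; ++⁺; map⁺; shifts; ++-comm; ↭-singleton-inv; All-resp-↭)
open import Function using (_∘_; id)
open import Level using (0ℓ)
open import Relation.Binary.PropositionalEquality using (_≡_; refl; isEquivalence; sym; trans; cong; cong₂; module ≡-Reasoning)

concatMap-cong-↭ : {A B : Set} {f g : A → List B} → (∀ x → f x ↭ g x) → ∀ xs → concatMap f xs ↭ concatMap g xs
concatMap-cong-↭ f↭g []       = ↭-refl
concatMap-cong-↭ f↭g (x ∷ xs) = ++⁺ (f↭g x) (concatMap-cong-↭ f↭g xs)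

concatMap-concatMap : {A B C : Set} (g : B → List C) (f : A → List B) (xs : List A) →
                      concatMap g (concatMap f xs) ≡ concatMap (concatMap g ∘ f) xs
concatMap-concatMap g f []       = refl
concatMap-concatMap g f (x ∷ xs) =
  trans (concatMap-++ g (f x) (concatMap f xs)) (cong (concatMap g (f x) ++_) (concatMap-concatMap g f xs))

applyUpTo-cong : {A : Set} (n : ℕ) {f g : ℕ → A} → (∀ i → i < n → f i ≡ g i) → applyUpTo f n ≡ applyUpTo g n
applyUpTo-cong zero    f≡g = refl
applyUpTo-cong (suc n) f≡g = cong₂ _∷_ (f≡g 0 z<s) (applyUpTo-cong n (λ i i<n → f≡g (suc i) (s<s i<n)))

applyUpTo-+ : {A : Set} (m n : ℕ) (g : ℕ → A) → applyUpTo g (m + n) ≡ applyUpTo g m ++ applyUpTo (g ∘ (m +_)) n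
applyUpTo-+ zero    n g = refl
applyUpTo-+ (suc m) n g = cong (g 0 ∷_) (applyUpTo-+ m n (g ∘ suc))

countᵇ : {A : Set} → (A → Bool) → List A → ℕ
countᵇ p xs = sum (map (λ x → if p x then 1 else 0) xs)

countᵇ-map : {A B : Set} (p : B → Bool) (g : A → B) (xs : List A) → countᵇ p (map g xs) ≡ countᵇ (p ∘ g) xs
countᵇ-map p g xs = cong sum (sym (map-∘ xs))

countᵇ-cong : {A : Set} {p q : A → Bool} → (∀ x → p x ≡ q x) → ∀ xs → countᵇ p xs ≡ countᵇ q xs
countᵇ-cong p≗q xs = cong sum (map-cong (λ x → cong (if_then 1 else 0) (p≗q x)) xs)

countᵇ-cong-All : {A : Set} {P : A → Set} {p q : A → Bool} →
                  (∀ {x} → P x → p x ≡ q x) → ∀ {xs} → All P xs → countᵇ p xs ≡ countᵇ q xs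
countᵇ-cong-All p≗q Pxs = cong sum (map-cong-local (All.map (λ Px → cong (if_then 1 else 0) (p≗q Px)) Pxs))

countᵇ-false : {A : Set} {p : A → Bool} → (∀ x → p x ≡ false) → ∀ xs → countᵇ p xs ≡ 0
countᵇ-false p≡false []       = refl
countᵇ-false p≡false (x ∷ xs) rewrite p≡false x = countᵇ-false p≡false xs

-- Multisets over a commutative monoid

module Multiset {V : Set} {_∙_ : Op₂ V} {ε : V}
                (isCommutativeMonoid : IsCommutativeMonoid _≡_ _∙_ ε) where

  open IsCommutativeMonoid isCommutativeMonoid using (assoc; comm; identityˡ; identityʳ; isMonoid)
  private
    monoid : Monoid 0ℓ 0ℓ
    monoid = record { isMonoid = isMonoid }

  open MonoidMultiplication monoid using () renaming (_×_ to _·_; ×-homo-+ to ·-homo-+)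
  open PermutationReasoning

  infixr 6 _▹_
  infixr 7 _⊛_

  _▹_ : V → List V → List V
  a ▹ xs = map (a ∙_) xs

  ▹-++ : ∀ a xs ys → a ▹ (xs ++ ys) ≡ a ▹ xs ++ a ▹ ys
  ▹-++ a = map-++ (a ∙_)

  ▹-▹ : ∀ a b xs → a ▹ b ▹ xs ≡ (a ∙ b) ▹ xs
  ▹-▹ a b xs = trans (sym (map-∘ xs)) (map-cong (λ x → sym (assoc a b x)) xs)

  ε▹ : ∀ xs → ε ▹ xs ≡ xs
  ε▹ xs = trans (map-cong identityˡ xs) (map-id xs)

  ▹-comm : ∀ a b xs → a ▹ b ▹ xs ≡ b ▹ a ▹ xs
  ▹-comm a b xs = trans (▹-▹ a b xs) (trans (cong (_▹ xs) (comm a b)) (sym (▹-▹ b a xs)))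

  ▹-cancelˡ : ∀ (g : V → V) a {xs ys} → (∀ x → g (a ∙ x) ≡ x) → a ▹ xs ↭ a ▹ ys → xs ↭ ys
  ▹-cancelˡ g a {xs} {ys} g-inverse p = begin
    xs               ≡⟨ undo xs ⟨
    map g (a ▹ xs)   ↭⟨ map⁺ g p ⟩
    map g (a ▹ ys)   ≡⟨ undo ys ⟩
    ys               ∎
    where
    undo : ∀ zs → map g (a ▹ zs) ≡ zs
    undo zs = trans (sym (map-∘ zs)) (trans (map-cong g-inverse zs) (map-id zs))

  _⊛_ : List V → List V → List V
  _⊛_ = cartesianProductWith _∙_

  ⊛-zeroʳ : ∀ xs → xs ⊛ [] ≡ []
  ⊛-zeroʳ = cartesianProductWith-zeroʳ _∙_

  ⊛-distribʳ-++ : ∀ xs ys zs → (xs ++ ys) ⊛ zs ≡ xs ⊛ zs ++ ys ⊛ zs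
  ⊛-distribʳ-++ = cartesianProductWith-distribʳ-++ _∙_

  ⊛-distribˡ-++ : ∀ xs ys zs → xs ⊛ (ys ++ zs) ↭ xs ⊛ ys ++ xs ⊛ zs
  ⊛-distribˡ-++ []       ys zs = ↭-refl
  ⊛-distribˡ-++ (x ∷ xs) ys zs = begin
    x ▹ (ys ++ zs) ++ xs ⊛ (ys ++ zs)          ≡⟨ cong (_++ xs ⊛ (ys ++ zs)) (▹-++ x ys zs) ⟩
    (x ▹ ys ++ x ▹ zs) ++ xs ⊛ (ys ++ zs)      ≡⟨ ++-assoc (x ▹ ys) (x ▹ zs) _ ⟩
    x ▹ ys ++ x ▹ zs ++ xs ⊛ (ys ++ zs)        ↭⟨ ++⁺ˡ (x ▹ ys) (++⁺ˡ (x ▹ zs) (⊛-distribˡ-++ xs ys zs)) ⟩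
    x ▹ ys ++ x ▹ zs ++ xs ⊛ ys ++ xs ⊛ zs     ↭⟨ ++⁺ˡ (x ▹ ys) (shifts (x ▹ zs) (xs ⊛ ys)) ⟩
    x ▹ ys ++ xs ⊛ ys ++ x ▹ zs ++ xs ⊛ zs     ≡⟨ ++-assoc (x ▹ ys) (xs ⊛ ys) _ ⟨
    (x ∷ xs) ⊛ ys ++ (x ∷ xs) ⊛ zs             ∎

  ⊛⁺ˡ : ∀ {xs xs'} ys → xs ↭ xs' → xs ⊛ ys ↭ xs' ⊛ ys
  ⊛⁺ˡ ys Perm.refl          = ↭-refl
  ⊛⁺ˡ ys (Perm.prep x p)    = ++⁺ˡ (x ▹ ys) (⊛⁺ˡ ys p)
  ⊛⁺ˡ ys (Perm.swap x y p)  = ↭-trans (shifts (x ▹ ys) (y ▹ ys)) (++⁺ˡ (y ▹ ys) (++⁺ˡ (x ▹ ys) (⊛⁺ˡ ys p)))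
  ⊛⁺ˡ ys (Perm.trans p q)   = ↭-trans (⊛⁺ˡ ys p) (⊛⁺ˡ ys q)

  ⊛⁺ʳ : ∀ xs {ys ys'} → ys ↭ ys' → xs ⊛ ys ↭ xs ⊛ ys'
  ⊛⁺ʳ []       p = ↭-refl
  ⊛⁺ʳ (x ∷ xs) p = ++⁺ (map⁺ (x ∙_) p) (⊛⁺ʳ xs p)

  ⊛⁺ : ∀ {xs xs' ys ys'} → xs ↭ xs' → ys ↭ ys' → xs ⊛ ys ↭ xs' ⊛ ys'
  ⊛⁺ {xs' = xs'} {ys} p q = ↭-trans (⊛⁺ˡ ys p) (⊛⁺ʳ xs' q)

  ▹-⊛ : ∀ a xs ys → (a ▹ xs) ⊛ ys ≡ a ▹ (xs ⊛ ys)
  ▹-⊛ a []       ys = refl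
  ▹-⊛ a (x ∷ xs) ys = trans (cong₂ _++_ (sym (▹-▹ a x ys)) (▹-⊛ a xs ys)) (sym (▹-++ a (x ▹ ys) (xs ⊛ ys)))

  ⊛-▹ : ∀ b xs ys → xs ⊛ (b ▹ ys) ≡ b ▹ (xs ⊛ ys)
  ⊛-▹ b []       ys = refl
  ⊛-▹ b (x ∷ xs) ys = trans (cong₂ _++_ (▹-comm x b ys) (⊛-▹ b xs ys)) (sym (▹-++ b (x ▹ ys) (xs ⊛ ys)))

  ⊛-[-] : ∀ xs a → xs ⊛ [ a ] ≡ a ▹ xs
  ⊛-[-] []       a = refl
  ⊛-[-] (x ∷ xs) a = cong₂ _∷_ (comm x a) (⊛-[-] xs a)

  [-]-⊛ : ∀ a ys → [ a ] ⊛ ys ≡ a ▹ ys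
  [-]-⊛ a ys = ++-identityʳ (a ▹ ys)

  ⊛-comm : ∀ xs ys → xs ⊛ ys ↭ ys ⊛ xs
  ⊛-comm []       ys = ↭-reflexive (sym (⊛-zeroʳ ys))
  ⊛-comm (x ∷ xs) ys = begin
    x ▹ ys ++ xs ⊛ ys       ↭⟨ ++⁺ˡ (x ▹ ys) (⊛-comm xs ys) ⟩
    x ▹ ys ++ ys ⊛ xs       ≡⟨ cong (_++ ys ⊛ xs) (⊛-[-] ys x) ⟨
    ys ⊛ [ x ] ++ ys ⊛ xs   ↭⟨ ⊛-distribˡ-++ ys [ x ] xs ⟨
    ys ⊛ (x ∷ xs)           ∎

  ⊛-assoc : ∀ xs ys zs → (xs ⊛ ys) ⊛ zs ≡ xs ⊛ (ys ⊛ zs)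
  ⊛-assoc []       ys zs = refl
  ⊛-assoc (x ∷ xs) ys zs =
    trans (⊛-distribʳ-++ (x ▹ ys) (xs ⊛ ys) zs) (cong₂ _++_ (▹-⊛ x ys zs) (⊛-assoc xs ys zs))

  concatMap-⊛ : {A : Set} (f : A → List V) (ys : List V) (ts : List A) →
                concatMap (λ t → f t ⊛ ys) ts ≡ concatMap f ts ⊛ ys
  concatMap-⊛ f ys []       = refl
  concatMap-⊛ f ys (t ∷ ts) =
    trans (cong (f t ⊛ ys ++_) (concatMap-⊛ f ys ts)) (sym (⊛-distribʳ-++ (f t) _ ys))

  ⋃ : ℕ → (ℕ → List V) → List V
  ⋃ zero    F = []
  ⋃ (suc n) F = F 0 ++ ⋃ n (F ∘ suc)

  infix 5.5 ⋃
  syntax ⋃ n (λ i → F) = ⋃[ i < n ] F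

  ⋃-cong : ∀ n {F G : ℕ → List V} → (∀ i → F i ≡ G i) → ⋃ n F ≡ ⋃ n G
  ⋃-cong zero    F≡G = refl
  ⋃-cong (suc n) F≡G = cong₂ _++_ (F≡G 0) (⋃-cong n (F≡G ∘ suc))

  ⋃-cong-↭ : ∀ n {F G : ℕ → List V} → (∀ i → i < n → F i ↭ G i) → ⋃ n F ↭ ⋃ n G
  ⋃-cong-↭ zero    F↭G = ↭-refl
  ⋃-cong-↭ (suc n) F↭G = ++⁺ (F↭G 0 z<s) (⋃-cong-↭ n (λ i i<n → F↭G (suc i) (s<s i<n)))

  ⋃-empty : ∀ n → ⋃[ i < n ] [] ≡ []
  ⋃-empty zero    = refl
  ⋃-empty (suc n) = ⋃-empty n

  ⋃-++ : ∀ n F G → ⋃[ i < n ] (F i ++ G i) ↭ ⋃ n F ++ ⋃ n G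
  ⋃-++ zero    F G = ↭-refl
  ⋃-++ (suc n) F G = begin
    (F 0 ++ G 0) ++ ⋃[ i < n ] (F (suc i) ++ G (suc i))   ≡⟨ ++-assoc (F 0) (G 0) _ ⟩
    F 0 ++ G 0 ++ ⋃[ i < n ] (F (suc i) ++ G (suc i))     ↭⟨ ++⁺ˡ (F 0) (++⁺ˡ (G 0) (⋃-++ n (F ∘ suc) (G ∘ suc))) ⟩
    F 0 ++ G 0 ++ ⋃ n (F ∘ suc) ++ ⋃ n (G ∘ suc)         ↭⟨ ++⁺ˡ (F 0) (shifts (G 0) (⋃ n (F ∘ suc))) ⟩
    F 0 ++ ⋃ n (F ∘ suc) ++ G 0 ++ ⋃ n (G ∘ suc)         ≡⟨ ++-assoc (F 0) _ _ ⟨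
    ⋃ (suc n) F ++ ⋃ (suc n) G                           ∎

  ⋃-+ : ∀ m n F → ⋃ (m + n) F ≡ ⋃ m F ++ ⋃[ i < n ] F (m + i)
  ⋃-+ zero    n F = refl
  ⋃-+ (suc m) n F = trans (cong (F 0 ++_) (⋃-+ m n (F ∘ suc))) (sym (++-assoc (F 0) _ _))

  ⋃-reverse : ∀ n F → ⋃ n F ↭ ⋃[ i < n ] F (n ∸ suc i)
  ⋃-reverse zero    F = ↭-refl
  ⋃-reverse (suc n) F = begin
    ⋃ (suc n) F                      ↭⟨ ⋃-last n F ⟩
    ⋃ n F ++ F n                     ↭⟨ ++-comm (⋃ n F) (F n) ⟩
    F n ++ ⋃ n F                     ↭⟨ ++⁺ˡ (F n) (⋃-reverse n F) ⟩
    F n ++ ⋃[ i < n ] F (n ∸ suc i)  ∎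
    where
    ⋃-last : ∀ n F → ⋃ (suc n) F ↭ ⋃ n F ++ F n
    ⋃-last zero    F = ↭-reflexive (++-identityʳ (F 0))
    ⋃-last (suc n) F = ↭-trans (++⁺ˡ (F 0) (⋃-last n (F ∘ suc))) (↭-reflexive (sym (++-assoc (F 0) _ _)))

  ⋃-triangle : ∀ n (G : ℕ → ℕ → List V) →
               ⋃[ r < n ] ⋃[ j < suc r ] G j r ↭ ⋃[ j < n ] ⋃[ i < n ∸ j ] G j (j + i)
  ⋃-triangle zero    G = ↭-refl
  ⋃-triangle (suc n) G = begin
    (G 0 0 ++ []) ++ ⋃[ r < n ] (G 0 (suc r) ++ ⋃[ j < suc r ] G (suc j) (suc r))
      ≡⟨ ++-assoc (G 0 0) [] _ ⟩
    G 0 0 ++ ⋃[ r < n ] (G 0 (suc r) ++ ⋃[ j < suc r ] G (suc j) (suc r))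
      ↭⟨ ++⁺ˡ (G 0 0) (⋃-++ n (G 0 ∘ suc) (λ r → ⋃[ j < suc r ] G (suc j) (suc r))) ⟩
    G 0 0 ++ ⋃ n (G 0 ∘ suc) ++ ⋃[ r < n ] ⋃[ j < suc r ] G (suc j) (suc r)
      ↭⟨ ++⁺ˡ (G 0 0) (++⁺ˡ (⋃ n (G 0 ∘ suc)) (⋃-triangle n (λ j r → G (suc j) (suc r)))) ⟩
    G 0 0 ++ ⋃ n (G 0 ∘ suc) ++ ⋃[ j < n ] ⋃[ i < n ∸ j ] G (suc j) (suc (j + i))
      ≡⟨ ++-assoc (G 0 0) _ _ ⟨
    ⋃[ j < suc n ] ⋃[ i < suc n ∸ j ] G j (j + i)
      ∎

  ⋃-⊛ : ∀ n F ys → ⋃ n F ⊛ ys ≡ ⋃[ i < n ] F i ⊛ ys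
  ⋃-⊛ zero    F ys = refl
  ⋃-⊛ (suc n) F ys = trans (⊛-distribʳ-++ (F 0) _ ys) (cong (F 0 ⊛ ys ++_) (⋃-⊛ n (F ∘ suc) ys))

  ⊛-⋃ : ∀ n xs F → xs ⊛ ⋃ n F ↭ ⋃[ i < n ] xs ⊛ F i
  ⊛-⋃ zero    xs F = ↭-reflexive (⊛-zeroʳ xs)
  ⊛-⋃ (suc n) xs F = ↭-trans (⊛-distribˡ-++ xs (F 0) _) (++⁺ˡ (xs ⊛ F 0) (⊛-⋃ n xs (F ∘ suc)))

  ▹-⋃ : ∀ n a F → a ▹ ⋃ n F ≡ ⋃[ i < n ] a ▹ F i
  ▹-⋃ zero    a F = refl
  ▹-⋃ (suc n) a F = trans (▹-++ a (F 0) _) (cong (a ▹ F 0 ++_) (▹-⋃ n a (F ∘ suc)))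

  concatMap-⋃ : {A : Set} (ts : List A) (n : ℕ) (G : A → ℕ → List V) →
                concatMap (λ t → ⋃ n (G t)) ts ↭ ⋃[ i < n ] concatMap (λ t → G t i) ts
  concatMap-⋃ []       n G = ↭-reflexive (sym (⋃-empty n))
  concatMap-⋃ (t ∷ ts) n G =
    ↭-trans (++⁺ˡ (⋃ n (G t)) (concatMap-⋃ ts n G)) (↭-sym (⋃-++ n (G t) (λ i → concatMap (λ t → G t i) ts)))

  ·-ε : ∀ n → n · ε ≡ ε
  ·-ε zero    = refl
  ·-ε (suc n) = trans (identityˡ (n · ε)) (·-ε n)

  -- The additive reading of the complete homogeneous symmetric polynomial h_r:
  -- the multiset of sums of all size-r submultisets of w.
  complete : ℕ → List V → List V
  complete zero    w       = [ ε ]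
  complete (suc r) []      = []
  complete (suc r) (a ∷ w) = complete (suc r) w ++ a ▹ complete r (a ∷ w)

  complete-[-] : ∀ r a → complete r [ a ] ≡ [ r · a ]
  complete-[-] zero    a = refl
  complete-[-] (suc r) a = cong (a ▹_) (complete-[-] r a)

  complete-++ : ∀ x y r → complete r (x ++ y) ↭ ⋃[ i < suc r ] complete i x ⊛ complete (r ∸ i) y
  complete-++ [] y r = begin
    complete r y                             ≡⟨ ε▹ (complete r y) ⟨
    ε ▹ complete r y                         ≡⟨ ++-identityʳ _ ⟨
    ε ▹ complete r y ++ []                   ≡⟨ cong₂ _++_ ([-]-⊛ ε (complete r y)) (⋃-empty r) ⟨
    [ ε ] ⊛ complete r y ++ ⋃[ i < r ] []    ∎
  complete-++ (a ∷ x) y zero = ↭-reflexive (cong [_] (sym (identityˡ ε)))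
  complete-++ (a ∷ x) y (suc r) = begin
    complete (suc r) (x ++ y) ++ a ▹ complete r (a ∷ x ++ y)
      ↭⟨ ++⁺ (complete-++ x y (suc r)) (map⁺ (a ∙_) (complete-++ (a ∷ x) y r)) ⟩
    ([ ε ] ⊛ Y ++ ⋃[ i < suc r ] complete (suc i) x ⊛ C i) ++ a ▹ (⋃[ i < suc r ] X i ⊛ C i)
      ≡⟨ cong (([ ε ] ⊛ Y ++ ⋃[ i < suc r ] complete (suc i) x ⊛ C i) ++_) (▹-⋃ (suc r) a (λ i → X i ⊛ C i)) ⟩
    ([ ε ] ⊛ Y ++ ⋃[ i < suc r ] complete (suc i) x ⊛ C i) ++ ⋃[ i < suc r ] a ▹ X i ⊛ C i
      ≡⟨ ++-assoc ([ ε ] ⊛ Y) _ _ ⟩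
    [ ε ] ⊛ Y ++ ⋃[ i < suc r ] complete (suc i) x ⊛ C i ++ ⋃[ i < suc r ] a ▹ X i ⊛ C i
      ↭⟨ ++⁺ˡ ([ ε ] ⊛ Y) (⋃-++ (suc r) (λ i → complete (suc i) x ⊛ C i) (λ i → a ▹ X i ⊛ C i)) ⟨
    [ ε ] ⊛ Y ++ ⋃[ i < suc r ] (complete (suc i) x ⊛ C i ++ a ▹ X i ⊛ C i)
      ≡⟨ cong ([ ε ] ⊛ Y ++_) (⋃-cong (suc r) λ i → sym (trans
           (⊛-distribʳ-++ (complete (suc i) x) (a ▹ X i) (C i))
           (cong (complete (suc i) x ⊛ C i ++_) (▹-⊛ a (X i) (C i))))) ⟩
    ⋃[ i < suc (suc r) ] complete i (a ∷ x) ⊛ complete (suc r ∸ i) y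
      ∎
    where
    X : ℕ → List V
    X i = complete i (a ∷ x)
    C : ℕ → List V
    C i = complete (r ∸ i) y
    Y : List V
    Y = complete (suc r) y

  complete-∷ : ∀ a w r → complete r (a ∷ w) ↭ ⋃[ i < suc r ] (i · a) ▹ complete (r ∸ i) w
  complete-∷ a w r = ↭-trans (complete-++ [ a ] w r) (⋃-cong-↭ (suc r) λ i _ → ↭-reflexive (singleton-⊛ i))
    where
    singleton-⊛ : ∀ i → complete i [ a ] ⊛ complete (r ∸ i) w ≡ (i · a) ▹ complete (r ∸ i) w
    singleton-⊛ i = trans (cong (_⊛ complete (r ∸ i) w) (complete-[-] i a)) ([-]-⊛ (i · a) _)

  complete-▹ : ∀ e w r → complete r (e ▹ w) ≡ (r · e) ▹ complete r w
  complete-▹ e w       zero    = cong [_] (sym (identityˡ ε))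
  complete-▹ e []      (suc r) = refl
  complete-▹ e (a ∷ w) (suc r) = trans
    (cong₂ _++_ (complete-▹ e w (suc r)) last-summand)
    (sym (▹-++ (suc r · e) (complete (suc r) w) _))
    where
    e∙a∙re : (e ∙ a) ∙ (r · e) ≡ (e ∙ (r · e)) ∙ a
    e∙a∙re = trans (assoc e a _) (trans (cong (e ∙_) (comm a _)) (sym (assoc e _ a)))
    last-summand : (e ∙ a) ▹ complete r (e ▹ (a ∷ w)) ≡ (suc r · e) ▹ a ▹ complete r (a ∷ w)
    last-summand = trans (cong ((e ∙ a) ▹_) (complete-▹ e (a ∷ w) r))
             (trans (▹-▹ (e ∙ a) (r · e) _)
             (trans (cong (_▹ complete r (a ∷ w)) e∙a∙re)
                    (sym (▹-▹ (suc r · e) a _))))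

  complete-ε∷ : ∀ w r → complete r (ε ∷ w) ↭ ⋃[ j < suc r ] complete j w
  complete-ε∷ w r = begin
    complete r (ε ∷ w)
      ↭⟨ complete-∷ ε w r ⟩
    ⋃[ i < suc r ] (i · ε) ▹ complete (r ∸ i) w
      ≡⟨ ⋃-cong (suc r) (λ i → trans (cong (_▹ complete (r ∸ i) w) (·-ε i)) (ε▹ (complete (r ∸ i) w))) ⟩
    ⋃[ i < suc r ] complete (r ∸ i) w
      ↭⟨ ⋃-reverse (suc r) (λ j → complete j w) ⟨
    ⋃[ j < suc r ] complete j w
      ∎

  complete-pair : ∀ a b r → complete r (a ∷ b ∷ []) ↭ ⋃[ i < suc r ] [ (i · a) ∙ ((r ∸ i) · b) ]
  complete-pair a b r = ↭-trans (complete-∷ a [ b ] r)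
    (↭-reflexive (⋃-cong (suc r) λ i → cong ((i · a) ▹_) (complete-[-] (r ∸ i) b)))

  complete-swap : ∀ a b r → complete r (a ∷ b ∷ []) ↭ complete r (b ∷ a ∷ [])
  complete-swap a b r = begin
    complete r (a ∷ b ∷ [])
      ↭⟨ complete-pair a b r ⟩
    ⋃[ i < suc r ] [ (i · a) ∙ ((r ∸ i) · b) ]
      ↭⟨ ⋃-reverse (suc r) (λ i → [ (i · a) ∙ ((r ∸ i) · b) ]) ⟩
    ⋃[ i < suc r ] [ ((r ∸ i) · a) ∙ ((r ∸ (r ∸ i)) · b) ]
      ↭⟨ ⋃-cong-↭ (suc r) (λ i i≤r → ↭-reflexive (cong [_] (trans (comm _ _)
           (cong (λ k → (k · b) ∙ ((r ∸ i) · a)) (ℕ.m∸[m∸n]≡n (ℕ.≤-pred i≤r)))))) ⟩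
    ⋃[ i < suc r ] [ (i · b) ∙ ((r ∸ i) · a) ]
      ↭⟨ complete-pair b a r ⟨
    complete r (b ∷ a ∷ [])
      ∎

  complete-↭ : ∀ r {w w'} → w ↭ w' → complete r w ↭ complete r w'
  complete-↭ r Perm.refl = ↭-refl
  complete-↭ r (Perm.prep {xs} {ys} a p) = begin
    complete r (a ∷ xs)
      ↭⟨ complete-∷ a xs r ⟩
    ⋃[ i < suc r ] (i · a) ▹ complete (r ∸ i) xs
      ↭⟨ ⋃-cong-↭ (suc r) (λ i _ → map⁺ ((i · a) ∙_) (complete-↭ (r ∸ i) p)) ⟩
    ⋃[ i < suc r ] (i · a) ▹ complete (r ∸ i) ys
      ↭⟨ complete-∷ a ys r ⟨
    complete r (a ∷ ys)
      ∎
  complete-↭ r (Perm.swap {xs} {ys} a b p) = begin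
    complete r (a ∷ b ∷ xs)
      ↭⟨ complete-++ (a ∷ b ∷ []) xs r ⟩
    ⋃[ i < suc r ] complete i (a ∷ b ∷ []) ⊛ complete (r ∸ i) xs
      ↭⟨ ⋃-cong-↭ (suc r) (λ i _ → ⊛⁺ (complete-swap a b i) (complete-↭ (r ∸ i) p)) ⟩
    ⋃[ i < suc r ] complete i (b ∷ a ∷ []) ⊛ complete (r ∸ i) ys
      ↭⟨ complete-++ (b ∷ a ∷ []) ys r ⟨
    complete r (b ∷ a ∷ ys)
      ∎
  complete-↭ r (Perm.trans p q) = ↭-trans (complete-↭ r p) (complete-↭ r q)

  Split : Set
  Split = List V × V × List V

  consPrefix : V → Split → Split
  consPrefix a (p , m) = (a ∷ p , m)

  splits : List V → List Split
  splits []      = []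
  splits (a ∷ w) = ([ a ] , a , a ∷ w) ∷ map (consPrefix a) (splits w)

  splitAt : (ℕ → V) → ℕ → ℕ → Split
  splitAt g m k = (applyUpTo g (suc k) , g k , applyUpTo (g ∘ (k +_)) (m ∸ k))

  splits-applyUpTo : ∀ g m → splits (applyUpTo g m) ≡ applyUpTo (splitAt g m) m
  splits-applyUpTo g zero    = refl
  splits-applyUpTo g (suc m) = cong (_ ∷_)
    (trans (cong (map (consPrefix (g 0))) (splits-applyUpTo (g ∘ suc) m)) (map-applyUpTo _ _ m))

  splitSum : ℕ → ℕ → Split → List V
  splitSum α β (p , x , s) = x ▹ complete α p ⊛ complete β s

  splitSum-consPrefix : ∀ α β a t →
    splitSum α β (consPrefix a t) ↭ ⋃[ i < suc α ] (i · a) ▹ splitSum (α ∸ i) β t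
  splitSum-consPrefix α β a (p , x , s) = begin
    x ▹ complete α (a ∷ p) ⊛ complete β s
      ↭⟨ map⁺ (x ∙_) (⊛⁺ˡ (complete β s) (complete-∷ a p α)) ⟩
    x ▹ (⋃[ i < suc α ] (i · a) ▹ complete (α ∸ i) p) ⊛ complete β s
      ≡⟨ cong (x ▹_) (⋃-⊛ (suc α) (λ i → (i · a) ▹ complete (α ∸ i) p) (complete β s)) ⟩
    x ▹ (⋃[ i < suc α ] ((i · a) ▹ complete (α ∸ i) p) ⊛ complete β s)
      ≡⟨ ▹-⋃ (suc α) x (λ i → ((i · a) ▹ complete (α ∸ i) p) ⊛ complete β s) ⟩
    ⋃[ i < suc α ] x ▹ ((i · a) ▹ complete (α ∸ i) p) ⊛ complete β s
      ≡⟨ ⋃-cong (suc α) (λ i → trans (cong (x ▹_) (▹-⊛ (i · a) (complete (α ∸ i) p) (complete β s)))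
                                      (▹-comm x (i · a) _)) ⟩
    ⋃[ i < suc α ] (i · a) ▹ x ▹ complete (α ∸ i) p ⊛ complete β s
      ∎

  -- A submultiset of size α + β + 1 is split at the position k of its (α+1)-st smallest
  -- element into α elements of w₀ … w_k, the element w_k, and β elements of w_k … wₘ.
  splits-complete : ∀ α β w → concatMap (splitSum α β) (splits w) ↭ complete (suc (α + β)) w
  splits-complete α β []      = ↭-refl
  splits-complete α β (a ∷ w) = begin
    a ▹ complete α [ a ] ⊛ complete β (a ∷ w) ++ concatMap (splitSum α β) (map (consPrefix a) (splits w))
      ≡⟨ cong₂ _++_ first (concatMap-map (splitSum α β) (consPrefix a) (splits w)) ⟩
    X ++ concatMap (λ t → splitSum α β (consPrefix a t)) (splits w)
      ↭⟨ ++⁺ˡ X (concatMap-cong-↭ (splitSum-consPrefix α β a) (splits w)) ⟩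
    X ++ concatMap (λ t → ⋃[ i < suc α ] (i · a) ▹ splitSum (α ∸ i) β t) (splits w)
      ↭⟨ ++⁺ˡ X (concatMap-⋃ (splits w) (suc α) (λ t i → (i · a) ▹ splitSum (α ∸ i) β t)) ⟩
    X ++ ⋃[ i < suc α ] concatMap (λ t → (i · a) ▹ splitSum (α ∸ i) β t) (splits w)
      ≡⟨ cong (X ++_) (⋃-cong (suc α) (λ i → sym (map-concatMap ((i · a) ∙_) (splitSum (α ∸ i) β) (splits w)))) ⟩
    X ++ ⋃[ i < suc α ] (i · a) ▹ concatMap (splitSum (α ∸ i) β) (splits w)
      ↭⟨ ++⁺ˡ X (⋃-cong-↭ (suc α) (λ i _ → map⁺ ((i · a) ∙_) (splits-complete (α ∸ i) β w))) ⟩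
    X ++ ⋃[ i < suc α ] (i · a) ▹ complete (suc (α ∸ i + β)) w
      ↭⟨ ++-comm X _ ⟩
    ⋃[ i < suc α ] (i · a) ▹ complete (suc (α ∸ i + β)) w ++ X
      ↭⟨ ++⁺ (⋃-cong-↭ (suc α) (λ i i≤α → ↭-reflexive (cong (λ k → (i · a) ▹ complete k w) (index i i≤α))))
             (↭-trans (map⁺ ((a ∙ (α · a)) ∙_) (complete-∷ a w β))
                      (↭-reflexive (trans (▹-⋃ (suc β) (a ∙ (α · a)) (λ i → (i · a) ▹ complete (β ∸ i) w))
                                          (⋃-cong (suc β) second)))) ⟩
    ⋃ (suc α) F ++ ⋃[ i < suc β ] F (suc α + i)
      ≡⟨ ⋃-+ (suc α) (suc β) F ⟨
    ⋃ (suc α + suc β) F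
      ≡⟨ cong (λ n → ⋃ n F) (cong suc (ℕ.+-suc α β)) ⟩
    ⋃ (suc (suc (α + β))) F
      ↭⟨ complete-∷ a w (suc (α + β)) ⟨
    complete (suc (α + β)) (a ∷ w)
      ∎
    where
    X : List V
    X = (a ∙ (α · a)) ▹ complete β (a ∷ w)
    F : ℕ → List V
    F i = (i · a) ▹ complete (suc (α + β) ∸ i) w
    first : a ▹ complete α [ a ] ⊛ complete β (a ∷ w) ≡ X
    first = trans (cong (λ q → a ▹ q ⊛ complete β (a ∷ w)) (complete-[-] α a))
              (trans (cong (a ▹_) ([-]-⊛ (α · a) _)) (▹-▹ a (α · a) _))
    index : ∀ i → i < suc α → suc (α ∸ i + β) ≡ suc (α + β) ∸ i
    index i i≤α = sym (trans (ℕ.+-∸-comm β {o = i} (ℕ.<⇒≤ i≤α)) (cong (_+ β) (ℕ.+-∸-assoc 1 (ℕ.≤-pred i≤α))))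
    second : ∀ i → (a ∙ (α · a)) ▹ (i · a) ▹ complete (β ∸ i) w ≡ F (suc α + i)
    second i = trans (▹-▹ _ _ _) (cong₂ (λ c k → c ▹ complete k w)
      (trans (assoc a _ _) (cong (a ∙_) (sym (·-homo-+ a α i))))
      (sym (ℕ.[m+n]∸[m+o]≡n∸o α β i)))

  middle : Split → V
  middle (_ , x , _) = x

  module Offsets (e₁ e₂ : V) where

    childProfile : Split → List V
    childProfile (p , _ , s) = e₁ ▹ p ++ e₂ ▹ s

    -- Read w as the profile of a matching and e₁, e₂ as the increments of the statistic for
    -- a gap left, resp. right, of the new vertex: offsets l w lists the increments over all
    -- descendants at depth l, a split being the choice of the gap closed by the new edge.
    offsets : ℕ → List V → List V
    offsets zero    w = [ ε ]
    offsets (suc l) w = concatMap (λ t → middle t ▹ offsets l (ε ∷ childProfile t)) (splits w)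

    completeₑ : ℕ → List V
    completeₑ j = complete j (e₁ ∷ e₂ ∷ [])

    coefficient : ℕ → ℕ → List V
    coefficient zero    zero    = [ ε ]
    coefficient zero    (suc r) = []
    coefficient (suc l) zero    = []
    coefficient (suc l) (suc j) = completeₑ j ⊛ (⋃[ i < suc l ∸ j ] coefficient l (j + i))

    weight : ℕ → ℕ → V
    weight j α = (α · e₁) ∙ ((j ∸ α) · e₂)

    complete-childProfile : ∀ j t →
      middle t ▹ complete j (childProfile t) ↭ ⋃[ α < suc j ] weight j α ▹ splitSum α (j ∸ α) t
    complete-childProfile j (p , x , s) = begin
      x ▹ complete j (e₁ ▹ p ++ e₂ ▹ s)
        ↭⟨ map⁺ (x ∙_) (complete-++ (e₁ ▹ p) (e₂ ▹ s) j) ⟩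
      x ▹ (⋃[ α < suc j ] complete α (e₁ ▹ p) ⊛ complete (j ∸ α) (e₂ ▹ s))
        ≡⟨ ▹-⋃ (suc j) x (λ α → complete α (e₁ ▹ p) ⊛ complete (j ∸ α) (e₂ ▹ s)) ⟩
      ⋃[ α < suc j ] x ▹ complete α (e₁ ▹ p) ⊛ complete (j ∸ α) (e₂ ▹ s)
        ≡⟨ ⋃-cong (suc j) (λ α → trans (cong (x ▹_) (factor α)) (▹-comm x (weight j α) _)) ⟩
      ⋃[ α < suc j ] weight j α ▹ x ▹ complete α p ⊛ complete (j ∸ α) s
        ∎
      where
      factor : ∀ α → complete α (e₁ ▹ p) ⊛ complete (j ∸ α) (e₂ ▹ s)
                     ≡ weight j α ▹ complete α p ⊛ complete (j ∸ α) s
      factor α = trans (cong₂ _⊛_ (complete-▹ e₁ p α) (complete-▹ e₂ s (j ∸ α)))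
        (trans (▹-⊛ (α · e₁) (complete α p) _)
        (trans (cong ((α · e₁) ▹_) (⊛-▹ ((j ∸ α) · e₂) (complete α p) (complete (j ∸ α) s)))
               (▹-▹ (α · e₁) ((j ∸ α) · e₂) _)))

    splits-complete-childProfile : ∀ j w →
      concatMap (λ t → middle t ▹ complete j (childProfile t)) (splits w) ↭ completeₑ j ⊛ complete (suc j) w
    splits-complete-childProfile j w = begin
      concatMap (λ t → middle t ▹ complete j (childProfile t)) (splits w)
        ↭⟨ concatMap-cong-↭ (complete-childProfile j) (splits w) ⟩
      concatMap (λ t → ⋃[ α < suc j ] weight j α ▹ splitSum α (j ∸ α) t) (splits w)
        ↭⟨ concatMap-⋃ (splits w) (suc j) (λ t α → weight j α ▹ splitSum α (j ∸ α) t) ⟩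
      ⋃[ α < suc j ] concatMap (λ t → weight j α ▹ splitSum α (j ∸ α) t) (splits w)
        ≡⟨ ⋃-cong (suc j) (λ α → sym (map-concatMap (weight j α ∙_) (splitSum α (j ∸ α)) (splits w))) ⟩
      ⋃[ α < suc j ] weight j α ▹ concatMap (splitSum α (j ∸ α)) (splits w)
        ↭⟨ ⋃-cong-↭ (suc j) (λ α α≤j → ↭-trans (map⁺ (weight j α ∙_) (splits-complete α (j ∸ α) w))
              (↭-reflexive (cong (λ k → weight j α ▹ complete (suc k) w) (ℕ.m+[n∸m]≡n (ℕ.≤-pred α≤j))))) ⟩
      ⋃[ α < suc j ] weight j α ▹ complete (suc j) w
        ≡⟨ ⋃-cong (suc j) (λ α → sym ([-]-⊛ (weight j α) (complete (suc j) w))) ⟩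
      ⋃[ α < suc j ] [ weight j α ] ⊛ complete (suc j) w
        ≡⟨ ⋃-⊛ (suc j) (λ α → [ weight j α ]) (complete (suc j) w) ⟨
      (⋃[ α < suc j ] [ weight j α ]) ⊛ complete (suc j) w
        ↭⟨ ⊛⁺ˡ (complete (suc j) w) (complete-pair e₁ e₂ j) ⟨
      completeₑ j ⊛ complete (suc j) w
        ∎

    closedForm : ℕ → List V → List V
    closedForm l w = ⋃[ r < suc l ] complete r w ⊛ coefficient l r

    closedForm-ε∷ : ∀ l t → middle t ▹ closedForm l (ε ∷ childProfile t)
      ↭ ⋃[ r < suc l ] ⋃[ j < suc r ] (middle t ▹ complete j (childProfile t)) ⊛ coefficient l r
    closedForm-ε∷ l t = begin
      x ▹ (⋃[ r < suc l ] complete r (ε ∷ q) ⊛ coefficient l r)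
        ≡⟨ ▹-⋃ (suc l) x (λ r → complete r (ε ∷ q) ⊛ coefficient l r) ⟩
      ⋃[ r < suc l ] x ▹ complete r (ε ∷ q) ⊛ coefficient l r
        ↭⟨ ⋃-cong-↭ (suc l) (λ r _ → map⁺ (x ∙_) (⊛⁺ˡ (coefficient l r) (complete-ε∷ q r))) ⟩
      ⋃[ r < suc l ] x ▹ (⋃[ j < suc r ] complete j q) ⊛ coefficient l r
        ≡⟨ ⋃-cong (suc l) (λ r → trans (cong (x ▹_) (⋃-⊛ (suc r) (λ j → complete j q) (coefficient l r)))
             (trans (▹-⋃ (suc r) x (λ j → complete j q ⊛ coefficient l r))
                    (⋃-cong (suc r) (λ j → sym (▹-⊛ x (complete j q) (coefficient l r)))))) ⟩
      ⋃[ r < suc l ] ⋃[ j < suc r ] (x ▹ complete j q) ⊛ coefficient l r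
        ∎
      where
      x = middle t
      q = childProfile t

    regroup : ∀ l j w → ⋃[ i < suc l ∸ j ] (completeₑ j ⊛ complete (suc j) w) ⊛ coefficient l (j + i)
                        ↭ complete (suc j) w ⊛ coefficient (suc l) (suc j)
    regroup l j w = begin
      ⋃[ i < suc l ∸ j ] (completeₑ j ⊛ complete (suc j) w) ⊛ coefficient l (j + i)
        ↭⟨ ⊛-⋃ (suc l ∸ j) (completeₑ j ⊛ complete (suc j) w) (λ i → coefficient l (j + i)) ⟨
      (completeₑ j ⊛ complete (suc j) w) ⊛ (⋃[ i < suc l ∸ j ] coefficient l (j + i))
        ↭⟨ ⊛⁺ˡ _ (⊛-comm (completeₑ j) (complete (suc j) w)) ⟩
      (complete (suc j) w ⊛ completeₑ j) ⊛ (⋃[ i < suc l ∸ j ] coefficient l (j + i))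
        ≡⟨ ⊛-assoc (complete (suc j) w) (completeₑ j) _ ⟩
      complete (suc j) w ⊛ coefficient (suc l) (suc j)
        ∎

    offsets-closedForm : ∀ l w → offsets l w ↭ closedForm l w
    offsets-closedForm zero    w = ↭-reflexive (cong [_] (sym (identityˡ ε)))
    offsets-closedForm (suc l) w = begin
      concatMap (λ t → middle t ▹ offsets l (ε ∷ childProfile t)) (splits w)
        ↭⟨ concatMap-cong-↭ (λ t → ↭-trans (map⁺ (middle t ∙_) (offsets-closedForm l (ε ∷ childProfile t)))
                                          (closedForm-ε∷ l t)) (splits w) ⟩
      concatMap (λ t → ⋃[ r < suc l ] ⋃[ j < suc r ] G t j r) (splits w)
        ↭⟨ concatMap-⋃ (splits w) (suc l) (λ t r → ⋃[ j < suc r ] G t j r) ⟩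
      ⋃[ r < suc l ] concatMap (λ t → ⋃[ j < suc r ] G t j r) (splits w)
        ↭⟨ ⋃-cong-↭ (suc l) (λ r _ → concatMap-⋃ (splits w) (suc r) (λ t j → G t j r)) ⟩
      ⋃[ r < suc l ] ⋃[ j < suc r ] concatMap (λ t → G t j r) (splits w)
        ↭⟨ ⋃-cong-↭ (suc l) (λ r _ → ⋃-cong-↭ (suc r) (λ j _ → ↭-trans
              (↭-reflexive (concatMap-⊛ (λ t → middle t ▹ complete j (childProfile t)) (coefficient l r) (splits w)))
              (⊛⁺ˡ (coefficient l r) (splits-complete-childProfile j w)))) ⟩
      ⋃[ r < suc l ] ⋃[ j < suc r ] (completeₑ j ⊛ complete (suc j) w) ⊛ coefficient l r
        ↭⟨ ⋃-triangle (suc l) (λ j r → (completeₑ j ⊛ complete (suc j) w) ⊛ coefficient l r) ⟩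
      ⋃[ j < suc l ] ⋃[ i < suc l ∸ j ] (completeₑ j ⊛ complete (suc j) w) ⊛ coefficient l (j + i)
        ↭⟨ ⋃-cong-↭ (suc l) (λ j _ → regroup l j w) ⟩
      ⋃[ j < suc l ] complete (suc j) w ⊛ coefficient (suc l) (suc j)
        ∎
      where
      G : Split → ℕ → ℕ → List V
      G t j r = (middle t ▹ complete j (childProfile t)) ⊛ coefficient l r

    offsets-↭ : ∀ l {w w'} → w ↭ w' → offsets l w ↭ offsets l w'
    offsets-↭ l {w} {w'} p = begin
      offsets l w      ↭⟨ offsets-closedForm l w ⟩
      closedForm l w   ↭⟨ ⋃-cong-↭ (suc l) (λ r _ → ⊛⁺ˡ (coefficient l r) (complete-↭ r p)) ⟩
      closedForm l w'  ↭⟨ offsets-closedForm l w' ⟨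
      offsets l w'     ∎

    offsets-1 : ∀ w → offsets 1 w ≡ w
    offsets-1 []      = refl
    offsets-1 (a ∷ w) = cong₂ _∷_ (identityʳ a)
      (trans (concatMap-map (λ t → middle t ▹ [ ε ]) (consPrefix a) (splits w)) (offsets-1 w))

  offsets-swap : ∀ e₁ e₂ l w → Offsets.offsets e₁ e₂ l w ↭ Offsets.offsets e₂ e₁ l w
  offsets-swap e₁ e₂ l w = begin
    offsets e₁ e₂ l w      ↭⟨ offsets-closedForm e₁ e₂ l w ⟩
    closedForm e₁ e₂ l w   ↭⟨ ⋃-cong-↭ (suc l) (λ r _ → ⊛⁺ʳ (complete r w) (coefficient-swap l r)) ⟩
    closedForm e₂ e₁ l w   ↭⟨ offsets-closedForm e₂ e₁ l w ⟨
    offsets e₂ e₁ l w      ∎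
    where
    open Offsets
    coefficient-swap : ∀ l r → coefficient e₁ e₂ l r ↭ coefficient e₂ e₁ l r
    coefficient-swap zero    zero    = ↭-refl
    coefficient-swap zero    (suc r) = ↭-refl
    coefficient-swap (suc l) zero    = ↭-refl
    coefficient-swap (suc l) (suc j) =
      ⊛⁺ (complete-swap e₁ e₂ j) (⋃-cong-↭ (suc l ∸ j) (λ i _ → coefficient-swap l (j + i)))

  offsets-unordered : ∀ {e₁ e₂ e₁' e₂'} → (e₁ , e₂) ≡ (e₁' , e₂') ⊎ (e₁ , e₂) ≡ (e₂' , e₁') →
                      ∀ l w → Offsets.offsets e₁ e₂ l w ↭ Offsets.offsets e₁' e₂' l w
  offsets-unordered (inj₁ refl) l w = ↭-refl
  offsets-unordered (inj₂ refl) l w = offsets-swap _ _ l w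

module Transport {V W : Set} {_∙_ : Op₂ V} {ε : V} {_⊞_ : Op₂ W} {o : W}
                 (V-isCommutativeMonoid : IsCommutativeMonoid _≡_ _∙_ ε)
                 (W-isCommutativeMonoid : IsCommutativeMonoid _≡_ _⊞_ o)
                 (f : V → W) (homo : ∀ a b → f (a ∙ b) ≡ f a ⊞ f b) (ε-homo : f ε ≡ o) where

  private
    module A = Multiset V-isCommutativeMonoid
    module B = Multiset W-isCommutativeMonoid

    mapSplit : A.Split → B.Split
    mapSplit (p , x , s) = (map f p , f x , map f s)

    splits-map : ∀ w → B.splits (map f w) ≡ map mapSplit (A.splits w)
    splits-map []      = refl
    splits-map (a ∷ w) = cong (_ ∷_) (trans (cong (map (B.consPrefix (f a))) (splits-map w))
                                     (trans (sym (map-∘ (A.splits w))) (map-∘ (A.splits w))))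

  map-▹ : ∀ a xs → map f (a A.▹ xs) ≡ f a B.▹ map f xs
  map-▹ a xs = trans (sym (map-∘ xs)) (trans (map-cong (homo a) xs) (map-∘ xs))

  map-offsets : ∀ e₁ e₂ l w → map f (A.Offsets.offsets e₁ e₂ l w) ≡ B.Offsets.offsets (f e₁) (f e₂) l (map f w)
  map-offsets e₁ e₂ zero    w = cong [_] ε-homo
  map-offsets e₁ e₂ (suc l) w = begin
    map f (concatMap offsetsᴬ (A.splits w))              ≡⟨ map-concatMap f offsetsᴬ (A.splits w) ⟩
    concatMap (map f ∘ offsetsᴬ) (A.splits w)           ≡⟨ concatMap-cong step (A.splits w) ⟩
    concatMap (offsetsᴮ ∘ mapSplit) (A.splits w)        ≡⟨ concatMap-map offsetsᴮ mapSplit (A.splits w) ⟨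
    concatMap offsetsᴮ (map mapSplit (A.splits w))      ≡⟨ cong (concatMap offsetsᴮ) (splits-map w) ⟨
    concatMap offsetsᴮ (B.splits (map f w))             ∎
    where
    open ≡-Reasoning
    offsetsᴬ : A.Split → List V
    offsetsᴬ t = A.middle t A.▹ A.Offsets.offsets e₁ e₂ l (ε ∷ A.Offsets.childProfile e₁ e₂ t)
    offsetsᴮ : B.Split → List W
    offsetsᴮ t = B.middle t B.▹ B.Offsets.offsets (f e₁) (f e₂) l (o ∷ B.Offsets.childProfile (f e₁) (f e₂) t)
    step : ∀ t → map f (offsetsᴬ t) ≡ offsetsᴮ (mapSplit t)
    step (p , x , s) = trans (map-▹ x _) (cong (f x B.▹_) (trans (map-offsets e₁ e₂ l _)
      (cong (B.Offsets.offsets (f e₁) (f e₂) l) (cong₂ _∷_ ε-homo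
        (trans (map-++ f (e₁ A.▹ p) _) (cong₂ _++_ (map-▹ e₁ p) (map-▹ e₂ s)))))))

-- Relabelling, crossings and nestings

<⇒<ᵇ≡true : ∀ {m n} → m < n → (m <ᵇ n) ≡ true
<⇒<ᵇ≡true {zero}  {suc n} _           = refl
<⇒<ᵇ≡true {suc m} {suc n} (s≤s m<n)   = <⇒<ᵇ≡true m<n

≥⇒<ᵇ≡false : ∀ {m n} → n ≤ m → (m <ᵇ n) ≡ false
≥⇒<ᵇ≡false {m}     {zero}  _         = refl
≥⇒<ᵇ≡false {suc m} {suc n} (s≤s n≤m) = ≥⇒<ᵇ≡false n≤m

<ᵇ≡true⇒< : ∀ m n → (m <ᵇ n) ≡ true → m < n
<ᵇ≡true⇒< zero    (suc n) _ = z<s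
<ᵇ≡true⇒< (suc m) (suc n) e = s<s (<ᵇ≡true⇒< m n e)

<ᵇ≡false⇒≥ : ∀ m n → (m <ᵇ n) ≡ false → n ≤ m
<ᵇ≡false⇒≥ m       zero    _ = z≤n
<ᵇ≡false⇒≥ (suc m) (suc n) e = s≤s (<ᵇ≡false⇒≥ m n e)

shift-<ᵇ : ∀ x u v → (shift x u <ᵇ shift x v) ≡ (u <ᵇ v)
shift-<ᵇ x u v with suc u <ᵇ x in eu | suc v <ᵇ x in ev
... | true  | true  = refl
... | false | false = refl
... | true  | false = trans (<⇒<ᵇ≡true (ℕ.m≤n⇒m≤1+n u<v)) (sym (<⇒<ᵇ≡true u<v))
  where
  u<v : u < v
  u<v = ℕ.≤-pred (ℕ.<-≤-trans (<ᵇ≡true⇒< (suc u) x eu) (<ᵇ≡false⇒≥ (suc v) x ev))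
... | false | true  = trans (≥⇒<ᵇ≡false (ℕ.m≤n⇒m≤1+n (ℕ.<⇒≤ v<u))) (sym (≥⇒<ᵇ≡false (ℕ.<⇒≤ v<u)))
  where
  v<u : v < u
  v<u = ℕ.≤-pred (ℕ.<-≤-trans (<ᵇ≡true⇒< (suc v) x ev) (<ᵇ≡false⇒≥ (suc u) x eu))

shift-<ᵇ-left : ∀ k j a → j ≤ k → (shift (2 + k) a <ᵇ 2 + j) ≡ (a <ᵇ suc j)
shift-<ᵇ-left k j a j≤k with a <ᵇ suc k in e
... | true  = refl
... | false = trans (≥⇒<ᵇ≡false (ℕ.≤-trans j≤k (ℕ.<⇒≤ k<a))) (sym (≥⇒<ᵇ≡false (ℕ.≤-trans (s≤s j≤k) k<a)))
  where
  k<a : k < a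
  k<a = <ᵇ≡false⇒≥ a (suc k) e

<ᵇ-shift-left : ∀ k j b → j ≤ k → (suc j <ᵇ shift (2 + k) b) ≡ (j <ᵇ b)
<ᵇ-shift-left k j b j≤k with b <ᵇ suc k in e
... | true  = refl
... | false = trans (<⇒<ᵇ≡true (s≤s (ℕ.≤-trans j≤k (ℕ.<⇒≤ k<b)))) (sym (<⇒<ᵇ≡true (ℕ.≤-<-trans j≤k k<b)))
  where
  k<b : k < b
  k<b = <ᵇ≡false⇒≥ b (suc k) e

shift-<ᵇ-right : ∀ k j a → k ≤ j → (shift (2 + k) a <ᵇ 3 + j) ≡ (a <ᵇ suc j)
shift-<ᵇ-right k j a k≤j with a <ᵇ suc k in e
... | false = refl
... | true  = trans (<⇒<ᵇ≡true (ℕ.m≤n⇒m≤1+n a≤j)) (sym (<⇒<ᵇ≡true a≤j))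
  where
  a≤j : a < suc j
  a≤j = ℕ.<-≤-trans (<ᵇ≡true⇒< a (suc k) e) (s≤s k≤j)

<ᵇ-shift-right : ∀ k j b → k ≤ j → (2 + j <ᵇ shift (2 + k) b) ≡ (j <ᵇ b)
<ᵇ-shift-right k j b k≤j with b <ᵇ suc k in e
... | false = refl
... | true  = trans (≥⇒<ᵇ≡false (ℕ.m≤n⇒m≤1+n b≤j)) (sym (≥⇒<ᵇ≡false b≤j))
  where
  b≤j : b ≤ j
  b≤j = ℕ.≤-trans (ℕ.≤-pred (<ᵇ≡true⇒< b (suc k) e)) k≤j

shift-≮ᵇ1 : ∀ x a → (shift x a <ᵇ 1) ≡ false
shift-≮ᵇ1 x a with suc a <ᵇ x
... | true  = refl
... | false = refl

countPairs-∷ : ∀ P e M → countPairs P (e ∷ M) ≡ countᵇ (P e) M + countPairs P M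
countPairs-∷ P e M = begin
  sum (map indicator (map (e ,_) M ++ pairs M))                ≡⟨ cong sum (map-++ indicator (map (e ,_) M) (pairs M)) ⟩
  sum (map indicator (map (e ,_) M) ++ map indicator (pairs M)) ≡⟨ sum-++ (map indicator (map (e ,_) M)) _ ⟩
  sum (map indicator (map (e ,_) M)) + countPairs P M          ≡⟨ cong (_+ countPairs P M) (countᵇ-map _ (e ,_) M) ⟩
  countᵇ (P e) M + countPairs P M                              ∎
  where
  open ≡-Reasoning
  indicator : Edge × Edge → ℕ
  indicator (e , e') = if P e e' then 1 else 0

countPairs-map : ∀ P (g : Edge → Edge) → (∀ e e' → P (g e) (g e') ≡ P e e') →
                 ∀ M → countPairs P (map g M) ≡ countPairs P M
countPairs-map P g P∘g M = trans (cong (countᵇ _) (pairs-map M))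
  (trans (countᵇ-map _ _ (pairs M)) (countᵇ-cong (λ (e , e') → P∘g e e') (pairs M)))
  where
  pairs-map : ∀ M → pairs (map g M) ≡ map (λ (e , e') → g e , g e') (pairs M)
  pairs-map []      = refl
  pairs-map (e ∷ M) = trans (cong₂ _++_ (trans (sym (map-∘ M)) (map-∘ M)) (pairs-map M))
    (sym (map-++ _ (map (e ,_) M) (pairs M)))

ℕ² : Set
ℕ² = ℕ × ℕ

infixl 6 _⊕_
_⊕_ : ℕ² → ℕ² → ℕ²
(a , b) ⊕ (c , d) = (a + c , b + d)

_⊖_ : ℕ² → ℕ² → ℕ²
(a , b) ⊖ (c , d) = (a ∸ c , b ∸ d)

⊕-⊖ : ∀ p q → (p ⊕ q) ⊖ p ≡ q
⊕-⊖ (a , b) (c , d) = cong₂ _,_ (ℕ.m+n∸m≡n a c) (ℕ.m+n∸m≡n b d)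

⊕-isCommutativeMonoid : IsCommutativeMonoid _≡_ _⊕_ (0 , 0)
⊕-isCommutativeMonoid = isCommutativeMonoidˡ (record
  { isSemigroup = record
    { isMagma = record { isEquivalence = isEquivalence ; ∙-cong = cong₂ _⊕_ }
    ; assoc   = λ (a , b) (c , d) (e , f) → cong₂ _,_ (ℕ.+-assoc a c e) (ℕ.+-assoc b d f)
    }
  ; identityˡ = λ _ → refl
  ; comm      = λ (a , b) (c , d) → cong₂ _,_ (ℕ.+-comm a c) (ℕ.+-comm b d)
  })

relabel : ℕ → Edge → Edge
relabel x (a , b) = (shift x a , shift x b)

-- Gap k lies between the vertices k and k + 1, so the child whose new edge is {1, k + 2}
-- gains a crossing with each edge spanning gap k and a nesting with each edge left of it.
spansᵇ : ℕ → Edge → Bool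
spansᵇ k (a , b) = (a <ᵇ suc k) ∧ (k <ᵇ b)

leftOfᵇ : ℕ → Edge → Bool
leftOfᵇ k (a , b) = b <ᵇ suc k

gapWeight : Matching → ℕ → ℕ²
gapWeight M k = (countᵇ (spansᵇ k) M , countᵇ (leftOfᵇ k) M)

profile : Matching → List ℕ²
profile M = applyUpTo (gapWeight M) (suc (2 * length M))

ProperEdge : Edge → Set
ProperEdge (a , b) = 1 ≤ a × a < b

Proper : Matching → Set
Proper = All ProperEdge

crossesᵇ-newEdge : ∀ k {e} → ProperEdge e → crossesᵇ (1 , 2 + k) (relabel (2 + k) e) ≡ spansᵇ k e
crossesᵇ-newEdge k {suc a , b} _ with suc a <ᵇ suc k in e
... | true  rewrite e = trans (∨-identityʳ _) (<ᵇ-shift-right k k b ℕ.≤-refl)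
... | false rewrite ≥⇒<ᵇ≡false {suc a} {k} (ℕ.≤-pred (ℕ.m≤n⇒m≤1+n (<ᵇ≡false⇒≥ (suc a) (suc k) e))) = refl

nestedᵇ-newEdge : ∀ k {e} → ProperEdge e → nestedᵇ (1 , 2 + k) (relabel (2 + k) e) ≡ leftOfᵇ k e
-- The split on suc a <ᵇ suc k only serves to let shift (2 + k) (suc a) compute.
nestedᵇ-newEdge k {suc a , b} (_ , a<b) rewrite shift-<ᵇ (2 + k) (suc a) b | <⇒<ᵇ≡true a<b with suc a <ᵇ suc k
... | true  = trans (∨-identityʳ _) (shift-<ᵇ-left k k b ℕ.≤-refl)
... | false = trans (∨-identityʳ _) (shift-<ᵇ-left k k b ℕ.≤-refl)

cn-child : ∀ k {M} → Proper M → cn (child M (2 + k)) ≡ cn M ⊕ gapWeight M k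
cn-child k {M} proper = cong₂ _,_
  (newEdge crossesᵇ (spansᵇ k) (crossesᵇ-newEdge k) (relabel-invariant crossesᵇ-relabel))
  (newEdge nestedᵇ (leftOfᵇ k) (nestedᵇ-newEdge k) (relabel-invariant nestedᵇ-relabel))
  where
  x = 2 + k
  relabel-invariant : ∀ {P} → (∀ a b c d → P (relabel x (a , b)) (relabel x (c , d)) ≡ P (a , b) (c , d)) →
                      countPairs P (map (relabel x) M) ≡ countPairs P M
  relabel-invariant {P} inv = countPairs-map P (relabel x) (λ (a , b) (c , d) → inv a b c d) M
  crossesᵇ-relabel : ∀ a b c d → crossesᵇ (relabel x (a , b)) (relabel x (c , d)) ≡ crossesᵇ (a , b) (c , d)
  crossesᵇ-relabel a b c d
    rewrite shift-<ᵇ x a c | shift-<ᵇ x c b | shift-<ᵇ x b d | shift-<ᵇ x c a | shift-<ᵇ x a d | shift-<ᵇ x d b = refl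
  nestedᵇ-relabel : ∀ a b c d → nestedᵇ (relabel x (a , b)) (relabel x (c , d)) ≡ nestedᵇ (a , b) (c , d)
  nestedᵇ-relabel a b c d
    rewrite shift-<ᵇ x a c | shift-<ᵇ x c d | shift-<ᵇ x d b | shift-<ᵇ x c a | shift-<ᵇ x a b | shift-<ᵇ x b d = refl
  newEdge : ∀ P (p : Edge → Bool) → (∀ {e} → ProperEdge e → P (1 , x) (relabel x e) ≡ p e) →
            countPairs P (map (relabel x) M) ≡ countPairs P M →
            countPairs P (child M x) ≡ countPairs P M + countᵇ p M
  newEdge P p gain invariant = begin
    countPairs P ((1 , x) ∷ map (relabel x) M)                          ≡⟨ countPairs-∷ P (1 , x) (map (relabel x) M) ⟩
    countᵇ (P (1 , x)) (map (relabel x) M) + countPairs P (map (relabel x) M)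
      ≡⟨ cong₂ _+_ (trans (countᵇ-map _ (relabel x) M) (countᵇ-cong-All gain proper)) invariant ⟩
    countᵇ p M + countPairs P M                                          ≡⟨ ℕ.+-comm (countᵇ p M) _ ⟩
    countPairs P M + countᵇ p M                                          ∎
    where open ≡-Reasoning

gapWeight-relabel : ∀ x M {j j'} →
  (∀ e → spansᵇ j' (relabel x e) ≡ spansᵇ j e) → (∀ e → leftOfᵇ j' (relabel x e) ≡ leftOfᵇ j e) →
  gapWeight (map (relabel x) M) j' ≡ gapWeight M j
gapWeight-relabel x M spans leftOf = cong₂ _,_
  (trans (countᵇ-map _ (relabel x) M) (countᵇ-cong spans M))
  (trans (countᵇ-map _ (relabel x) M) (countᵇ-cong leftOf M))

gapWeight-child-0 : ∀ k M → gapWeight (child M (2 + k)) 0 ≡ (0 , 0)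
gapWeight-child-0 k M = cong₂ _,_
  (trans (countᵇ-map _ (relabel x) M) (countᵇ-false (λ (a , b) → cong (_∧ (0 <ᵇ shift x b)) (shift-≮ᵇ1 x a)) M))
  (trans (countᵇ-map _ (relabel x) M) (countᵇ-false (λ (_ , b) → shift-≮ᵇ1 x b) M))
  where x = 2 + k

gapWeight-child-left : ∀ k j M → j ≤ k → gapWeight (child M (2 + k)) (suc j) ≡ (1 , 0) ⊕ gapWeight M j
gapWeight-child-left k j M j≤k rewrite <⇒<ᵇ≡true {j} {suc k} (s≤s j≤k) | ≥⇒<ᵇ≡false {k} {j} j≤k =
  cong (λ (c , d) → (suc c , d)) (gapWeight-relabel (2 + k) M
    (λ (a , b) → cong₂ _∧_ (shift-<ᵇ-left k j a j≤k) (<ᵇ-shift-left k j b j≤k))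
    (λ (_ , b) → shift-<ᵇ-left k j b j≤k))

gapWeight-child-right : ∀ k j M → k ≤ j → gapWeight (child M (2 + k)) (2 + j) ≡ (0 , 1) ⊕ gapWeight M j
gapWeight-child-right k j M k≤j rewrite ≥⇒<ᵇ≡false {j} {k} k≤j | <⇒<ᵇ≡true {k} {suc j} (s≤s k≤j) =
  cong (λ (c , d) → (c , suc d)) (gapWeight-relabel (2 + k) M
    (λ (a , b) → cong₂ _∧_ (shift-<ᵇ-right k j a k≤j) (<ᵇ-shift-right k j b k≤j))
    (λ (_ , b) → shift-<ᵇ-right k j b k≤j))

module Pairs = Multiset ⊕-isCommutativeMonoid

childProfile : Pairs.Split → List ℕ²
childProfile = Pairs.Offsets.childProfile (1 , 0) (0 , 1)

gapSplit : Matching → ℕ → Pairs.Split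
gapSplit M = Pairs.splitAt (gapWeight M) (suc (2 * length M))

profile-child : ∀ k M → k < suc (2 * length M) → profile (child M (2 + k)) ≡ (0 , 0) ∷ childProfile (gapSplit M k)
profile-child k M k<m = begin
  applyUpTo W (suc (2 * length (child M (2 + k))))
    ≡⟨ cong (λ n → applyUpTo W (suc n)) length-child ⟩
  W 0 ∷ applyUpTo (W ∘ suc) (suc (k + (m ∸ k)))
    ≡⟨ cong₂ _∷_ (gapWeight-child-0 k M) (applyUpTo-+ (suc k) (m ∸ k) (W ∘ suc)) ⟩
  (0 , 0) ∷ applyUpTo (W ∘ suc) (suc k) ++ applyUpTo (W ∘ (2 + k +_)) (m ∸ k)
    ≡⟨ cong ((0 , 0) ∷_) (cong₂ _++_
         (trans (applyUpTo-cong (suc k) (λ j j≤k → gapWeight-child-left k j M (ℕ.≤-pred j≤k)))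
                (sym (map-applyUpTo (gapWeight M) ((1 , 0) ⊕_) (suc k))))
         (trans (applyUpTo-cong (m ∸ k) (λ i _ → gapWeight-child-right k (k + i) M (ℕ.m≤m+n k i)))
                (sym (map-applyUpTo (gapWeight M ∘ (k +_)) ((0 , 1) ⊕_) (m ∸ k))))) ⟩
  (0 , 0) ∷ childProfile (gapSplit M k)
    ∎
  where
  open ≡-Reasoning
  m = suc (2 * length M)
  W = gapWeight (child M (2 + k))
  length-child : 2 * length (child M (2 + k)) ≡ suc (k + (m ∸ k))
  length-child = begin
    2 * suc (length (map (relabel (2 + k)) M))   ≡⟨ cong (λ n → 2 * suc n) (length-map (relabel (2 + k)) M) ⟩
    2 * suc (length M)                           ≡⟨ ℕ.*-suc 2 (length M) ⟩
    suc m                                        ≡⟨ cong suc (ℕ.m+[n∸m]≡n (ℕ.<⇒≤ k<m)) ⟨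
    suc (k + (m ∸ k))                            ∎

Proper-child : ∀ k {M} → Proper M → Proper (child M (2 + k))
Proper-child k proper = (s≤s z≤n , s≤s (s≤s z≤n)) ∷ map⁺ₐ (All.map relabel-proper proper)
  where
  shift-positive : ∀ x a → 1 ≤ shift x a
  shift-positive x a with suc a <ᵇ x
  ... | true  = s≤s z≤n
  ... | false = s≤s z≤n
  relabel-proper : ∀ {e} → ProperEdge e → ProperEdge (relabel (2 + k) e)
  relabel-proper {a , b} (_ , a<b) =
    shift-positive (2 + k) a , <ᵇ≡true⇒< _ _ (trans (shift-<ᵇ (2 + k) a b) (<⇒<ᵇ≡true a<b))

IsMatching⇒Proper : ∀ {n M} → IsMatching n M → Proper M
IsMatching⇒Proper {n} {M} isMatching = All.zip (endpoints-positive M endpoints-≥1 , IsMatching.ordered isMatching)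
  where
  oneTo-positive : ∀ k → All (1 ≤_) (oneTo k)
  oneTo-positive k = map⁺ₐ (All.universal (λ _ → s≤s z≤n) (upTo k))
  endpoints-≥1 : All (1 ≤_) (endpoints M)
  endpoints-≥1 = All-resp-↭ (↭-sym (IsMatching.covers isMatching)) (oneTo-positive (2 * n))
  endpoints-positive : ∀ M → All (1 ≤_) (endpoints M) → All (λ e → 1 ≤ proj₁ e) M
  endpoints-positive []      []             = []
  endpoints-positive (_ ∷ M) (1≤a ∷ _ ∷ ps) = 1≤a ∷ endpoints-positive M ps

-- The multiset cn(𝒯(M,l))

T-suc : ∀ l M → T M (suc l) ≡ concatMap (λ c → T c l) (children M)
T-suc zero    M = trans (++-identityʳ (children M)) (sym (concatMap-pure (children M)))
T-suc (suc l) M = trans (cong (concatMap children) (T-suc l M)) (concatMap-concatMap children (λ c → T c l) (children M))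

offsets : ℕ → List ℕ² → List ℕ²
offsets = Pairs.Offsets.offsets (1 , 0) (0 , 1)

map-cn-T : ∀ l {M} → Proper M → map cn (T M l) ≡ cn M Pairs.▹ offsets l (profile M)
map-cn-T zero    {M} _      = cong [_] (sym (IsCommutativeMonoid.identityʳ ⊕-isCommutativeMonoid (cn M)))
map-cn-T (suc l) {M} proper = begin
  map cn (T M (suc l))
    ≡⟨ cong (map cn) (T-suc l M) ⟩
  map cn (concatMap (λ c → T c l) (children M))
    ≡⟨ map-concatMap cn (λ c → T c l) (children M) ⟩
  concatMap (λ c → map cn (T c l)) (children M)
    ≡⟨ concatMap-map (λ c → map cn (T c l)) (λ i → child M (2 + i)) (upTo m) ⟩
  concatMap (λ i → map cn (T (child M (2 + i)) l)) (upTo m)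
    ≡⟨ cong concat (trans (map-upTo _ m) (trans (applyUpTo-cong m child-offsets) (sym (map-upTo _ m)))) ⟩
  concatMap (λ i → cn M Pairs.▹ descend (gapSplit M i)) (upTo m)
    ≡⟨ map-concatMap (cn M ⊕_) (descend ∘ gapSplit M) (upTo m) ⟨
  cn M Pairs.▹ concatMap (descend ∘ gapSplit M) (upTo m)
    ≡⟨ cong (cn M Pairs.▹_) (concatMap-map descend (gapSplit M) (upTo m)) ⟨
  cn M Pairs.▹ concatMap descend (map (gapSplit M) (upTo m))
    ≡⟨ cong (λ ts → cn M Pairs.▹ concatMap descend ts)
         (trans (map-upTo (gapSplit M) m) (sym (Pairs.splits-applyUpTo (gapWeight M) m))) ⟩
  cn M Pairs.▹ offsets (suc l) (profile M)
    ∎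
  where
  open ≡-Reasoning
  m = suc (2 * length M)
  descend : Pairs.Split → List ℕ²
  descend t = Pairs.middle t Pairs.▹ offsets l ((0 , 0) ∷ childProfile t)
  child-offsets : ∀ i → i < m → map cn (T (child M (2 + i)) l) ≡ cn M Pairs.▹ descend (gapSplit M i)
  child-offsets i i<m = begin
    map cn (T (child M (2 + i)) l)
      ≡⟨ map-cn-T l (Proper-child i proper) ⟩
    cn (child M (2 + i)) Pairs.▹ offsets l (profile (child M (2 + i)))
      ≡⟨ cong₂ (λ c w → c Pairs.▹ offsets l w) (cn-child i proper) (profile-child i M i<m) ⟩
    (cn M ⊕ gapWeight M i) Pairs.▹ offsets l ((0 , 0) ∷ childProfile (gapSplit M i))
      ≡⟨ Pairs.▹-▹ (cn M) (gapWeight M i) _ ⟨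
    cn M Pairs.▹ descend (gapSplit M i)
      ∎

-- Linear statistics

module LinearStatistics {W : Set} {_⊞_ : Op₂ W} {o : W} (isCommutativeMonoid : IsCommutativeMonoid _≡_ _⊞_ o) where

  open Multiset isCommutativeMonoid

  record Linear (σ : Matching → W) : Set where
    field
      coefficients : ℕ² → W
      homo         : ∀ a b → coefficients (a ⊕ b) ≡ coefficients a ⊞ coefficients b
      ε-homo       : coefficients (0 , 0) ≡ o
      factorises   : ∀ M → σ M ≡ coefficients (cn M)

    open Offsets (coefficients (1 , 0)) (coefficients (0 , 1)) public
      using () renaming (offsets to offsetsᶜ; offsets-↭ to offsetsᶜ-↭; offsets-1 to offsetsᶜ-1)

    map-T : ∀ l {M} → Proper M → map σ (T M l) ≡ σ M ▹ offsetsᶜ l (map coefficients (profile M))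
    map-T l {M} proper = begin
      map σ (T M l)                                          ≡⟨ map-cong factorises (T M l) ⟩
      map (coefficients ∘ cn) (T M l)                        ≡⟨ map-∘ (T M l) ⟩
      map coefficients (map cn (T M l))                      ≡⟨ cong (map coefficients) (map-cn-T l proper) ⟩
      map coefficients (cn M Pairs.▹ offsets l (profile M))  ≡⟨ map-▹ (cn M) (offsets l (profile M)) ⟩
      coefficients (cn M) ▹ map coefficients (offsets l (profile M))
        ≡⟨ cong₂ _▹_ (sym (factorises M)) (map-offsets (1 , 0) (0 , 1) l (profile M)) ⟩
      σ M ▹ offsetsᶜ l (map coefficients (profile M))        ∎
      where
      open ≡-Reasoning
      open Transport ⊕-isCommutativeMonoid isCommutativeMonoid coefficients homo ε-homo

  CoefficientsAgreeUpToOrder : ∀ {σ τ} → Linear σ → Linear τ → Set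
  CoefficientsAgreeUpToOrder σ-linear τ-linear =
    (f (1 , 0) , f (0 , 1)) ≡ (g (1 , 0) , g (0 , 1)) ⊎ (f (1 , 0) , f (0 , 1)) ≡ (g (0 , 1) , g (1 , 0))
    where
    f = Linear.coefficients σ-linear
    g = Linear.coefficients τ-linear

  determined-by-levels-0-and-1 :
    (_⊟_ : W → W → W) → (∀ a x → (a ⊞ x) ⊟ a ≡ x) →
    ∀ {σ τ} (σ-linear : Linear σ) (τ-linear : Linear τ) → CoefficientsAgreeUpToOrder σ-linear τ-linear →
    ∀ {M N} → Proper M → Proper N →
    map σ (T M 0) ↭ map τ (T N 0) → map σ (T M 1) ↭ map τ (T N 1) →
    ∀ l → map σ (T M l) ↭ map τ (T N l)
  determined-by-levels-0-and-1 _⊟_ ⊞-⊟ {σ} {τ} σ-linear τ-linear unordered {M} {N} proper-M proper-N level-0 level-1 l =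
    begin
    map σ (T M l)                   ≡⟨ σ.map-T l proper-M ⟩
    σ M ▹ σ.offsetsᶜ l wσ           ↭⟨ map⁺ (σ M ⊞_) (σ.offsetsᶜ-↭ l profiles-↭) ⟩
    σ M ▹ σ.offsetsᶜ l wτ           ↭⟨ map⁺ (σ M ⊞_) (offsets-unordered unordered l wτ) ⟩
    σ M ▹ τ.offsetsᶜ l wτ           ≡⟨ cong (_▹ τ.offsetsᶜ l wτ) σM≡τN ⟩
    τ N ▹ τ.offsetsᶜ l wτ           ≡⟨ τ.map-T l proper-N ⟨
    map τ (T N l)                   ∎
    where
    open PermutationReasoning
    module σ = Linear σ-linear
    module τ = Linear τ-linear
    wσ = map σ.coefficients (profile M)
    wτ = map τ.coefficients (profile N)
    σM≡τN : σ M ≡ τ N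
    σM≡τN = ∷-injectiveˡ (↭-singleton-inv level-0)
    profiles-↭ : wσ ↭ wτ
    profiles-↭ = ▹-cancelˡ (_⊟ σ M) (σ M) (⊞-⊟ (σ M)) (begin
      σ M ▹ wσ                 ≡⟨ cong (σ M ▹_) (σ.offsetsᶜ-1 wσ) ⟨
      σ M ▹ σ.offsetsᶜ 1 wσ    ≡⟨ σ.map-T 1 proper-M ⟨
      map σ (T M 1)            ↭⟨ level-1 ⟩
      map τ (T N 1)            ≡⟨ τ.map-T 1 proper-N ⟩
      τ N ▹ τ.offsetsᶜ 1 wτ    ≡⟨ cong₂ _▹_ (sym σM≡τN) (τ.offsetsᶜ-1 wτ) ⟩
      σ M ▹ wτ                 ∎)

open LinearStatistics using (Linear; CoefficientsAgreeUpToOrder; determined-by-levels-0-and-1)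

stat-linear : ∀ s → Linear ℕ.+-0-isCommutativeMonoid (stat s)
stat-linear CR = record { coefficients = proj₁ ; homo = λ _ _ → refl ; ε-homo = refl ; factorises = λ _ → refl }
stat-linear NE = record { coefficients = proj₂ ; homo = λ _ _ → refl ; ε-homo = refl ; factorises = λ _ → refl }

stat-coefficients : ∀ s t → CoefficientsAgreeUpToOrder ℕ.+-0-isCommutativeMonoid (stat-linear s) (stat-linear t)
stat-coefficients CR CR = inj₁ refl
stat-coefficients CR NE = inj₂ refl
stat-coefficients NE CR = inj₂ refl
stat-coefficients NE NE = inj₁ refl

pairStat-linear : ∀ u → Linear ⊕-isCommutativeMonoid (pairStat u)
pairStat-linear CN = record { coefficients = id   ; homo = λ _ _ → refl ; ε-homo = refl ; factorises = λ _ → refl }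
pairStat-linear NC = record { coefficients = swap ; homo = λ _ _ → refl ; ε-homo = refl ; factorises = λ _ → refl }

pairStat-coefficients : ∀ u v → CoefficientsAgreeUpToOrder ⊕-isCommutativeMonoid (pairStat-linear u) (pairStat-linear v)
pairStat-coefficients CN CN = inj₁ refl
pairStat-coefficients CN NC = inj₂ refl
pairStat-coefficients NC CN = inj₂ refl
pairStat-coefficients NC NC = inj₁ refl

theorem1p2 : (n : ℕ) (M N : Matching) → IsMatching n M → IsMatching n N →
      ((s t : Stat) →
        map (stat s) (T M 0) ↭ map (stat t) (T N 0) →
        map (stat s) (T M 1) ↭ map (stat t) (T N 1) →
        (l : ℕ) → map (stat s) (T M l) ↭ map (stat t) (T N l))
    × ((u v : PairStat) →
        map (pairStat u) (T M 0) ↭ map (pairStat v) (T N 0) →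
        map (pairStat u) (T M 1) ↭ map (pairStat v) (T N 1) →
        (l : ℕ) → map (pairStat u) (T M l) ↭ map (pairStat v) (T N l))
theorem1p2 n M N M-matching N-matching =
  (λ s t → determined-by-levels-0-and-1 ℕ.+-0-isCommutativeMonoid _∸_ ℕ.m+n∸m≡n
             (stat-linear s) (stat-linear t) (stat-coefficients s t) M-proper N-proper) ,
  (λ u v → determined-by-levels-0-and-1 ⊕-isCommutativeMonoid _⊖_ ⊕-⊖
             (pairStat-linear u) (pairStat-linear v) (pairStat-coefficients u v) M-proper N-proper)
  where
  M-proper = IsMatching⇒Proper M-matching
  N-proper = IsMatching⇒Proper N-matching
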